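{- Let $uvw$ be a positive triangle in a signed graph (i.e., the product of the signs of its three edges is positive), and let $\phi$ be an assignment of colors to $u$ and $w$ that is valid on the edge $uw$. Then the set $L(v)$ of colors $c$ such that assigning $c$ to $v$ is valid on the edges $uv$ and $wv$ is a set of three, four, or five cyclically consecutive colors.
   Context: The set of colors is $\pm[5]=\{\pm1,\dots,\pm5\}$, identified with the vertices of $K^s_{10;3}$ taken in the cyclic order $1,2,3,4,5,-1,-2,-3,-4,-5$ (so $-i$ plays the role of $i+5$ modulo $10$). Two colors at cyclic distance at most $2$ (including equal colors) are joined by a positive edge in $K^s_{10;3}$, and two colors at cyclic distance at least $3$ are joined by a negative edge. An assignment of colors is valid on an edge $xy$ of sign $s$ if the colors of $x$ and $y$ are joined in $K^s_{10;3}$ by an edge of sign $s$. -}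

module Defs where

open import Data.Nat using (ℕ; _+_; _∸_; _≤_; _<_; _⊔_; _⊓_)
open import Data.Nat.DivMod using (_%_)
open import Data.Fin using (Fin; toℕ; zero; suc)
open import Data.Product using (_×_)

data Sign : Set where
  plus minus : Sign

_·_ : Sign → Sign → Sign
plus  · s = s
minus · plus = minus
minus · minus = plus

-- The colour set ±[5] = {±1,…,±5}:  pos i is +(i+1), neg i is −(i+1).
data Color : Set where
  pos neg : Fin 5 → Color

-- Position of a colour in the cyclic order 1,2,3,4,5,−1,−2,−3,−4,−5
-- of the vertices of K^s_{10;3} (positions 0..9; −i is at position of i plus 5).
position : Color → ℕ
position (pos i) = toℕ i
position (neg i) = 5 + toℕ i

offset : ℕ → ℕ → ℕ
offset a b = (10 + b ∸ a) % 10

cdist : Color → Color → ℕ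
cdist a b = offset (position a) (position b) ⊓ offset (position b) (position a)

-- Edges of K^s_{10;3}: positive iff cyclic distance ≤ 2, negative iff ≥ 3.
-- A pair of colours is valid on an edge of sign s iff they are joined in
-- K^s_{10;3} by an edge of sign s.
Valid : Sign → Color → Color → Set
Valid plus  a b = cdist a b ≤ 2
Valid minus a b = 3 ≤ cdist a b

L : Sign → Sign → Color → Color → Color → Set
L suv swv cu cw c = Valid suv cu c × Valid swv cw c

InBlock : Color → ℕ → Color → Set
InBlock a k c = offset (position a) (position c) < k

-- Reading the negative edges of K^s_{10;3} at a colour x as the positive
-- edges at its antipode -x, the colours allowed at v are those within
-- cyclic distance 2 of both "centres" x' and y', where x' is φ(u) or -φ(u)
-- according to the sign of uv, and likewise y' for w.  Since the triangle
-- is positive, the sign of uw is the product of the other two, so validity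
-- of φ on uw says exactly that x' and y' are within distance 2.  Two arcs of
-- five consecutive colours with centres at distance d ≤ 2 meet in an arc of
-- 5 - d consecutive colours.  The finitely many colour configurations are
-- checked by evaluating decision procedures.
module Submission where

open import Defs
open import Data.Nat using (ℕ; _≤?_; _<?_)
open import Data.Nat.Properties using (_≟_)
open import Data.List using (List; map; _++_; allFin; upTo)
open import Data.List.Membership.Propositional using (_∈_)
open import Data.List.Membership.Propositional.Properties using (∈-++⁺ˡ; ∈-++⁺ʳ; ∈-map⁺; ∈-allFin)
open import Data.List.Relation.Unary.All as All using (All; all?)
open import Data.List.Relation.Unary.Any using (Any; any?; satisfied)
open import Data.Product using (Σ; _×_; _,_)
open import Data.Product.Function.NonDependent.Propositional using (_×-⇔_)
open import Data.Sum using (_⊎_)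
open import Function using (id; _∘_)
open import Function.Bundles using (_⇔_; mk⇔; Equivalence)
open import Function.Construct.Identity using (⇔-id)
open import Function.Construct.Composition using (_⇔-∘_)
open import Relation.Binary.PropositionalEquality using (_≡_; refl; subst)
open import Relation.Nullary using (Dec)
open import Relation.Nullary.Decidable using (True; toWitness; map′; _×-dec_; _→-dec_; _⊎-dec_)
open import Relation.Unary using (Decidable)

colors : List Color
colors = map pos (allFin 5) ++ map neg (allFin 5)

∈-colors : ∀ c → c ∈ colors
∈-colors (pos i) = ∈-++⁺ˡ (∈-map⁺ pos (∈-allFin i))
∈-colors (neg i) = ∈-++⁺ʳ (map pos (allFin 5)) (∈-map⁺ neg (∈-allFin i))

all-colors₂ : {P : Color → Color → Set} (P? : ∀ a b → Dec (P a b)) →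
  {True (all? (λ a → all? (P? a) colors) colors)} → ∀ a b → P a b
all-colors₂ P? {ok} a b = All.lookup (All.lookup (toWitness ok) (∈-colors a)) (∈-colors b)

_⇔-dec_ : {A B : Set} → Dec A → Dec B → Dec (A ⇔ B)
a? ⇔-dec b? = map′ (λ (f , g) → mk⇔ f g) (λ e → Equivalence.to e , Equivalence.from e)
  ((a? →-dec b?) ×-dec (b? →-dec a?))

Valid? : ∀ s a b → Dec (Valid s a b)
Valid? plus  a b = cdist a b ≤? 2
Valid? minus a b = 3 ≤? cdist a b

InBlock? : ∀ a k c → Dec (InBlock a k c)
InBlock? a k c = offset (position a) (position c) <? k

antipode : Color → Color
antipode (pos i) = neg i
antipode (neg i) = pos i

centre : Sign → Color → Color
centre plus  c = c
centre minus c = antipode c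

Valid⇔Valid-centre : ∀ s a b → Valid s a b ⇔ Valid plus (centre s a) b
Valid⇔Valid-centre plus  a b = ⇔-id _
Valid⇔Valid-centre minus a b =
  all-colors₂ (λ a b → Valid? minus a b ⇔-dec Valid? plus (antipode a) b) a b

Valid-·⇒Valid-centres : ∀ s t a b → Valid (s · t) a b → Valid plus (centre s a) (centre t b)
Valid-·⇒Valid-centres plus  plus  a b = id
Valid-·⇒Valid-centres plus  minus a b =
  all-colors₂ (λ a b → Valid? minus a b →-dec Valid? plus a (antipode b)) a b
Valid-·⇒Valid-centres minus plus  a b =
  all-colors₂ (λ a b → Valid? minus a b →-dec Valid? plus (antipode a) b) a b
Valid-·⇒Valid-centres minus minus a b =
  all-colors₂ (λ a b → Valid? plus a b →-dec Valid? plus (antipode a) (antipode b)) a b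

positive-triangle : ∀ s t u → (s · t) · u ≡ plus → u ≡ s · t
positive-triangle plus  plus  plus  _ = refl
positive-triangle plus  minus minus _ = refl
positive-triangle minus plus  minus _ = refl
positive-triangle minus minus plus  _ = refl

ConsecutiveBlock : (Color → Set) → Set
ConsecutiveBlock S = Σ Color λ a → Σ ℕ λ k → (k ≡ 3 ⊎ k ≡ 4 ⊎ k ≡ 5) ×
  ((c : Color) → S c ⇔ InBlock a k c)

ConsecutiveBlock-resp-⇔ : {S T : Color → Set} → (∀ c → S c ⇔ T c) →
  ConsecutiveBlock T → ConsecutiveBlock S
ConsecutiveBlock-resp-⇔ S⇔T (a , k , admissible , block) =
  a , k , admissible , λ c → block c ⇔-∘ S⇔T c

module _ {S : Color → Set} (S? : Decidable S) where

  BlockWitness : Color → ℕ → Set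
  BlockWitness a k = (k ≡ 3 ⊎ k ≡ 4 ⊎ k ≡ 5) × All (λ c → S c ⇔ InBlock a k c) colors

  block-search : Dec (Any (λ a → Any (BlockWitness a) (upTo 6)) colors)
  block-search = any? (λ a → any? (λ k →
    ((k ≟ 3) ⊎-dec (k ≟ 4) ⊎-dec (k ≟ 5)) ×-dec
    all? (λ c → S? c ⇔-dec InBlock? a k c) colors) (upTo 6)) colors

  found-block : Any (λ a → Any (BlockWitness a) (upTo 6)) colors → ConsecutiveBlock S
  found-block found with satisfied found
  ... | a , found-k with satisfied found-k
  ... | k , admissible , block = a , k , admissible , All.lookup block ∘ ∈-colors

NearBoth : Color → Color → Color → Set
NearBoth x y c = Valid plus x c × Valid plus y c

NearBoth-consecutive : ∀ x y → Valid plus x y → ConsecutiveBlock (NearBoth x y)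
NearBoth-consecutive x y near =
  found-block (near? x y) (all-colors₂ (λ x y → Valid? plus x y →-dec block-search (near? x y)) x y near)
  where
  near? : ∀ x y → Decidable (NearBoth x y)
  near? x y c = Valid? plus x c ×-dec Valid? plus y c

lemma2p6 : (suv svw suw : Sign) → (suv · svw) · suw ≡ plus →
    (φu φw : Color) → Valid suw φu φw →
    Σ Color (λ a → Σ ℕ (λ k → (k ≡ 3 ⊎ k ≡ 4 ⊎ k ≡ 5) ×
      ((c : Color) → L suv svw φu φw c ⇔ InBlock a k c)))
lemma2p6 suv svw suw positive φu φw φ-valid =
  ConsecutiveBlock-resp-⇔
    (λ c → Valid⇔Valid-centre suv φu c ×-⇔ Valid⇔Valid-centre svw φw c)
    (NearBoth-consecutive (centre suv φu) (centre svw φw) centres-near)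
  where
  centres-near : Valid plus (centre suv φu) (centre svw φw)
  centres-near = Valid-·⇒Valid-centres suv svw φu φw
    (subst (λ s → Valid s φu φw) (positive-triangle suv svw suw positive) φ-valid)
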